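{- Let $G$ be a graph with at least two vertices and fix a set-sequential labeling of $G$. Then the sum (in $\mathbb{F}_2^m$) of the labels of all vertices of $G$ of even degree is $0$.
   Context: A set-sequential labeling of a graph $G$ with labels in $\mathbb{F}_2^m$ is an assignment of distinct nonzero vectors of $\mathbb{F}_2^m$ to the vertices of $G$ such that, when each edge is labeled with the sum (mod 2) of the labels of its two endpoints, every nonzero vector of $\mathbb{F}_2^m$ occurs exactly once among all vertex labels and edge labels. -}

module Defs where

open import Data.Bool using (Bool; true; false; _xor_; T)
open import Data.Bool.Properties using () renaming (_≟_ to _≟ᵇ_)
open import Data.Nat using (ℕ; _%_; _≤_)
open import Data.Fin using (Fin; _<_)
open import Data.Fin.Properties using (_<?_)
open import Data.List using (List; []; _∷_; map; filter; filterᵇ; allFin; concatMap; length; foldr; _++_)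
open import Data.Vec using (Vec; zipWith; replicate)
open import Data.Vec.Properties using (≡-dec)
open import Data.Product using (_×_; _,_)
open import Relation.Binary.PropositionalEquality using (_≡_; _≢_)
open import Relation.Nullary using (¬_)
open import Relation.Nullary.Decidable using (⌊_⌋)

𝔽₂^ : ℕ → Set
𝔽₂^ m = Vec Bool m

_⊕_ : ∀ {m} → 𝔽₂^ m → 𝔽₂^ m → 𝔽₂^ m
_⊕_ = zipWith _xor_

𝟎 : ∀ {m} → 𝔽₂^ m
𝟎 = replicate _ false

_≟v_ : ∀ {m} (u v : 𝔽₂^ m) → Relation.Nullary.Dec (u ≡ v)
_≟v_ = ≡-dec _≟ᵇ_

Σ⊕ : ∀ {m} → List (𝔽₂^ m) → 𝔽₂^ m
Σ⊕ = foldr _⊕_ 𝟎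

record Graph (n : ℕ) : Set where
  field
    adj   : Fin n → Fin n → Bool
    sym   : ∀ i j → adj i j ≡ adj j i
    irrefl : ∀ i → adj i i ≡ false
open Graph public

edges : ∀ {n} → Graph n → List (Fin n × Fin n)
edges {n} G = concatMap (λ i → map (λ j → (i , j))
                  (filterᵇ (λ j → ⌊ i <? j ⌋ Data.Bool.∧ adj G i j) (allFin n)))
              (allFin n)

degree : ∀ {n} → Graph n → Fin n → ℕ
degree {n} G i = length (filterᵇ (adj G i) (allFin n))

count : ∀ {m} → 𝔽₂^ m → List (𝔽₂^ m) → ℕ
count v xs = length (filter (v ≟v_) xs)

allLabels : ∀ {n m} → Graph n → (Fin n → 𝔽₂^ m) → List (𝔽₂^ m)
allLabels {n} G ℓ = map ℓ (allFin n) ++ map (λ { (i , j) → ℓ i ⊕ ℓ j }) (edges G)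

record SetSequential {n : ℕ} (G : Graph n) (m : ℕ) (ℓ : Fin n → 𝔽₂^ m) : Set where
  field
    distinct : ∀ i j → ℓ i ≡ ℓ j → i ≡ j
    nonzero  : ∀ i → ℓ i ≢ 𝟎
    exactlyOnce : ∀ (v : 𝔽₂^ m) → v ≢ 𝟎 → count v (allLabels G ℓ) ≡ 1

evenDegreeSum : ∀ {n m} → Graph n → (Fin n → 𝔽₂^ m) → 𝔽₂^ m
evenDegreeSum {n} G ℓ =
  Σ⊕ (map ℓ (filter (λ i → degree G i % 2 Data.Nat.≟ 0) (allFin n)))

module Submission where

-- The proof computes the sum S of ALL labels (vertex labels and edge labels)
-- in two ways.
--  * Through the labelling.  F₂^m is a Boolean group (x ⊕ x = 0), so a list
--    sums to the sum of the vectors occurring in it an odd number of times.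
--    In a set-sequential labelling these are exactly the nonzero vectors, so
--    S is the sum of all of F₂^m, which vanishes once m ≥ 2.
--  * Through the graph.  The edge label ℓ i ⊕ ℓ j contributes ℓ i once for
--    every edge at i, so the edge labels sum to Σᵢ deg(i)·ℓ i (a handshake
--    identity), and S = Σᵢ (1 + deg i)·ℓ i is the sum over even-degree vertices.
-- The dimensions m = 0, 1 cannot occur: F₂^m then has fewer than two nonzero
-- vectors, but the two vertices need distinct nonzero labels.

open import Level using (Level)
open import Defs hiding (sym)
open import Data.Bool using (Bool; true; false; not; _xor_; _∧_; T?)
open import Data.Bool.Properties
  using (not-involutive; not-distribˡ-xor; xor-same; xor-assoc; xor-comm; xor-identityˡ; xor-identityʳ)
open import Data.Empty using (⊥-elim)
open import Data.Fin using (Fin; zero; suc)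
open import Data.Fin.Properties using (_<?_; <-cmp; <-asym; 0≢1+n)
open import Data.List using (List; []; _∷_; map; filter; filterᵇ; allFin; concatMap; length; foldr; _++_)
open import Data.List.Properties using (map-++; map-∘; map-id; length-++; length-map)
open import Data.Nat using (ℕ; zero; suc; _+_; _%_; _≤_; s≤s)
import Data.Nat as ℕ
open import Data.Product using (_×_; _,_; proj₁; proj₂)
open import Data.Vec using ([]; _∷_)
open import Data.Vec.Properties using (zipWith-assoc; zipWith-comm; zipWith-identityˡ)
open import Function using (_∘_; id)
open import Relation.Binary.Definitions using (tri<; tri≈; tri>)
open import Relation.Binary.PropositionalEquality using (_≡_; _≢_; refl; sym; trans; cong; cong₂)
open import Relation.Nullary using (yes; no; does)
open import Relation.Nullary.Decidable using (⌊_⌋)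
open import Relation.Unary using (Pred; Decidable)
open Relation.Binary.PropositionalEquality.≡-Reasoning

private
  variable
    b p : Level
    B : Set b

odd : ℕ → Bool
odd zero = false
odd (suc n) = not (odd n)

odd-+ : ∀ m n → odd (m + n) ≡ odd m xor odd n
odd-+ zero n = refl
odd-+ (suc m) n = trans (cong not (odd-+ m n)) (not-distribˡ-xor (odd m) (odd n))

odd-double : ∀ n → odd (n + n) ≡ false
odd-double n = trans (odd-+ n n) (xor-same (odd n))

even?-odd : ∀ n → does (n % 2 ℕ.≟ 0) ≡ not (odd n)
even?-odd zero = refl
even?-odd (suc zero) = refl
even?-odd (suc (suc n)) = trans (even?-odd n) (sym (not-involutive (not (odd n))))

ordered : ∀ {n} → Graph n → Fin n → Fin n → Bool
ordered G i j = ⌊ i <? j ⌋ ∧ adj G i j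

ordered-xor : ∀ {n} (G : Graph n) i j → ordered G i j xor ordered G j i ≡ adj G i j
ordered-xor G i j with i <? j | j <? i
... | yes i<j | yes j<i = ⊥-elim (<-asym i<j j<i)
... | yes _   | no _    = xor-identityʳ (adj G i j)
... | no _    | yes _   = Graph.sym G j i
... | no i≮j  | no j≮i  with <-cmp i j
...   | tri< i<j _ _ = ⊥-elim (i≮j i<j)
...   | tri> _ _ j<i = ⊥-elim (j≮i j<i)
...   | tri≈ _ refl _ = sym (Graph.irrefl G i)

-- Finite sums in a Boolean group: a commutative monoid in which every element
-- is its own inverse.  Such a group is a vector space over F₂ = Bool.
module BooleanGroup
  {a} {A : Set a} (_∙_ : A → A → A) (ε : A)
  (assoc : ∀ x y z → (x ∙ y) ∙ z ≡ x ∙ (y ∙ z))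
  (comm : ∀ x y → x ∙ y ≡ y ∙ x)
  (identityˡ : ∀ x → ε ∙ x ≡ x)
  (self-inverse : ∀ x → x ∙ x ≡ ε)
  where

  identityʳ : ∀ x → x ∙ ε ≡ x
  identityʳ x = trans (comm x ε) (identityˡ x)

  interchange : ∀ w x y z → (w ∙ x) ∙ (y ∙ z) ≡ (w ∙ y) ∙ (x ∙ z)
  interchange w x y z = begin
    (w ∙ x) ∙ (y ∙ z) ≡⟨ assoc w x (y ∙ z) ⟩
    w ∙ (x ∙ (y ∙ z)) ≡⟨ cong (w ∙_) (sym (assoc x y z)) ⟩
    w ∙ ((x ∙ y) ∙ z) ≡⟨ cong (λ t → w ∙ (t ∙ z)) (comm x y) ⟩
    w ∙ ((y ∙ x) ∙ z) ≡⟨ cong (w ∙_) (assoc y x z) ⟩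
    w ∙ (y ∙ (x ∙ z)) ≡⟨ sym (assoc w y (x ∙ z)) ⟩
    (w ∙ y) ∙ (x ∙ z) ∎

  _·_ : Bool → A → A
  true · x = x
  false · x = ε

  ·-xor : ∀ s t x → (s xor t) · x ≡ (s · x) ∙ (t · x)
  ·-xor false t x = sym (identityˡ (t · x))
  ·-xor true false x = sym (identityʳ x)
  ·-xor true true x = sym (self-inverse x)

  ·-∙ : ∀ s x y → s · (x ∙ y) ≡ (s · x) ∙ (s · y)
  ·-∙ false x y = sym (identityˡ ε)
  ·-∙ true x y = refl

  ·-ε : ∀ s → s · ε ≡ ε
  ·-ε false = refl
  ·-ε true = refl

  ∙-· : ∀ s x → x ∙ (s · x) ≡ not s · x
  ∙-· s x = sym (·-xor true s x)

  sum : List A → A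
  sum = foldr _∙_ ε

  ∑ : List B → (B → A) → A
  ∑ xs f = sum (map f xs)

  sum-++ : ∀ xs ys → sum (xs ++ ys) ≡ sum xs ∙ sum ys
  sum-++ [] ys = sym (identityˡ (sum ys))
  sum-++ (x ∷ xs) ys = trans (cong (x ∙_) (sum-++ xs ys)) (sym (assoc x (sum xs) (sum ys)))

  ∑-id : ∀ xs → ∑ xs id ≡ sum xs
  ∑-id xs = cong sum (map-id xs)

  ∑-++ : ∀ (xs ys : List B) (f : B → A) → ∑ (xs ++ ys) f ≡ ∑ xs f ∙ ∑ ys f
  ∑-++ xs ys f = trans (cong sum (map-++ f xs ys)) (sum-++ (map f xs) (map f ys))

  ∑-map : ∀ {c} {C : Set c} (f : C → A) (h : B → C) (xs : List B) → ∑ (map h xs) f ≡ ∑ xs (f ∘ h)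
  ∑-map f h xs = cong sum (sym (map-∘ xs))

  ∑-concatMap : ∀ {c} {C : Set c} (f : C → A) (F : B → List C) (xs : List B) →
    ∑ (concatMap F xs) f ≡ ∑ xs (λ x → ∑ (F x) f)
  ∑-concatMap f F [] = refl
  ∑-concatMap f F (x ∷ xs) =
    trans (∑-++ (F x) (concatMap F xs) f) (cong (∑ (F x) f ∙_) (∑-concatMap f F xs))

  ∑-cong : ∀ (xs : List B) {f g : B → A} → (∀ x → f x ≡ g x) → ∑ xs f ≡ ∑ xs g
  ∑-cong [] f≗g = refl
  ∑-cong (x ∷ xs) f≗g = cong₂ _∙_ (f≗g x) (∑-cong xs f≗g)

  ∑-ε : ∀ (xs : List B) → ∑ xs (λ _ → ε) ≡ ε
  ∑-ε [] = refl
  ∑-ε (x ∷ xs) = trans (identityˡ _) (∑-ε xs)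

  ∑-∙ : ∀ (xs : List B) (f g : B → A) → ∑ xs (λ x → f x ∙ g x) ≡ ∑ xs f ∙ ∑ xs g
  ∑-∙ [] f g = sym (identityˡ ε)
  ∑-∙ (x ∷ xs) f g =
    trans (cong ((f x ∙ g x) ∙_) (∑-∙ xs f g)) (interchange (f x) (g x) (∑ xs f) (∑ xs g))

  ∑-swap : ∀ {c} {C : Set c} (xs : List B) (ys : List C) (h : B → C → A) →
    ∑ xs (λ x → ∑ ys (h x)) ≡ ∑ ys (λ y → ∑ xs (λ x → h x y))
  ∑-swap [] ys h = sym (∑-ε ys)
  ∑-swap (x ∷ xs) ys h =
    trans (cong (∑ ys (h x) ∙_) (∑-swap xs ys h)) (sym (∑-∙ ys (h x) (λ y → ∑ xs (λ x → h x y))))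

  ∑-filter : ∀ {P : Pred B p} (P? : Decidable P) (f : B → A) (xs : List B) →
    ∑ (filter P? xs) f ≡ ∑ xs (λ x → does (P? x) · f x)
  ∑-filter P? f [] = refl
  ∑-filter P? f (x ∷ xs) with does (P? x)
  ... | false = trans (∑-filter P? f xs) (sym (identityˡ _))
  ... | true = cong (f x ∙_) (∑-filter P? f xs)

  ∑-const : ∀ (q : B → Bool) (x : A) (xs : List B) → ∑ xs (λ y → q y · x) ≡ odd (length (filterᵇ q xs)) · x
  ∑-const q x [] = refl
  ∑-const q x (y ∷ xs) with q y
  ... | false = trans (identityˡ _) (∑-const q x xs)
  ... | true = trans (cong (x ∙_) (∑-const q x xs)) (∙-· _ x)

  ∑-pairs : ∀ {B : Set b} (xs : List B) (r : B → B → Bool) (f : B → A) →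
    ∑ xs (λ i → ∑ xs (λ j → r i j · (f i ∙ f j))) ≡
    ∑ xs (λ i → ∑ xs (λ j → (r i j xor r j i) · f i))
  ∑-pairs {B = B} xs r f = begin
    ∑ xs (λ i → ∑ xs (λ j → r i j · (f i ∙ f j)))
      ≡⟨ ∑-cong xs (λ i → trans (∑-cong xs (λ j → ·-∙ (r i j) (f i) (f j))) (∑-∙ xs _ _)) ⟩
    ∑ xs (λ i → out i ∙ ∑ xs (λ j → r i j · f j))
      ≡⟨ ∑-∙ xs out _ ⟩
    ∑ xs out ∙ ∑ xs (λ i → ∑ xs (λ j → r i j · f j))
      ≡⟨ cong (∑ xs out ∙_) (∑-swap xs xs (λ i j → r i j · f j)) ⟩
    ∑ xs out ∙ ∑ xs (λ j → ∑ xs (λ i → r i j · f j))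
      ≡⟨ sym (∑-∙ xs out _) ⟩
    ∑ xs (λ i → out i ∙ ∑ xs (λ j → r j i · f i))
      ≡⟨ ∑-cong xs (λ i → trans (sym (∑-∙ xs _ _)) (∑-cong xs (λ j → sym (·-xor (r i j) (r j i) (f i))))) ⟩
    ∑ xs (λ i → ∑ xs (λ j → (r i j xor r j i) · f i)) ∎
    where
    out : B → A
    out i = ∑ xs (λ j → r i j · f i)

  ∑-edges : ∀ {n} (G : Graph n) (g : Fin n × Fin n → A) →
    ∑ (edges G) g ≡ ∑ (allFin n) (λ i → ∑ (allFin n) (λ j → ordered G i j · g (i , j)))
  ∑-edges {n} G g = begin
    ∑ (edges G) g
      ≡⟨ ∑-concatMap g (λ i → map (i ,_) (filterᵇ (ordered G i) V)) V ⟩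
    ∑ V (λ i → ∑ (map (i ,_) (filterᵇ (ordered G i) V)) g)
      ≡⟨ ∑-cong V (λ i → ∑-map g (i ,_) (filterᵇ (ordered G i) V)) ⟩
    ∑ V (λ i → ∑ (filterᵇ (ordered G i) V) (λ j → g (i , j)))
      ≡⟨ ∑-cong V (λ i → ∑-filter (T? ∘ ordered G i) (λ j → g (i , j)) V) ⟩
    ∑ V (λ i → ∑ V (λ j → ordered G i j · g (i , j))) ∎
    where
    V : List (Fin n)
    V = allFin n

  handshake : ∀ {n} (G : Graph n) (f : Fin n → A) →
    ∑ (edges G) (λ e → f (proj₁ e) ∙ f (proj₂ e)) ≡
    ∑ (allFin n) (λ i → odd (degree G i) · f i)
  handshake {n} G f = begin
    ∑ (edges G) (λ e → f (proj₁ e) ∙ f (proj₂ e))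
      ≡⟨ ∑-edges G (λ e → f (proj₁ e) ∙ f (proj₂ e)) ⟩
    ∑ V (λ i → ∑ V (λ j → ordered G i j · (f i ∙ f j)))
      ≡⟨ ∑-pairs V (ordered G) f ⟩
    ∑ V (λ i → ∑ V (λ j → (ordered G i j xor ordered G j i) · f i))
      ≡⟨ ∑-cong V (λ i → ∑-cong V (λ j → cong (_· f i) (ordered-xor G i j))) ⟩
    ∑ V (λ i → ∑ V (λ j → adj G i j · f i))
      ≡⟨ ∑-cong V (λ i → ∑-const (adj G i) (f i) V) ⟩
    ∑ V (λ i → odd (degree G i) · f i) ∎
    where
    V : List (Fin n)
    V = allFin n

⊕-assoc : ∀ {m} (x y z : 𝔽₂^ m) → (x ⊕ y) ⊕ z ≡ x ⊕ (y ⊕ z)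
⊕-assoc = zipWith-assoc xor-assoc

⊕-comm : ∀ {m} (x y : 𝔽₂^ m) → x ⊕ y ≡ y ⊕ x
⊕-comm = zipWith-comm xor-comm

⊕-identityˡ : ∀ {m} (x : 𝔽₂^ m) → 𝟎 ⊕ x ≡ x
⊕-identityˡ = zipWith-identityˡ xor-identityˡ

⊕-self-inverse : ∀ {m} (x : 𝔽₂^ m) → x ⊕ x ≡ 𝟎
⊕-self-inverse [] = refl
⊕-self-inverse (s ∷ x) = cong₂ _∷_ (xor-same s) (⊕-self-inverse x)

module F₂ {m : ℕ} = BooleanGroup (_⊕_ {m}) 𝟎 ⊕-assoc ⊕-comm ⊕-identityˡ ⊕-self-inverse
open F₂

vectors : (m : ℕ) → List (𝔽₂^ m)
vectors zero = [] ∷ []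
vectors (suc m) = map (false ∷_) (vectors m) ++ map (true ∷_) (vectors m)

-- Since x occurs exactly once in `vectors m`, selecting the summands equal
-- to x picks out the single value f x.
∑-select : ∀ {m k} (x : 𝔽₂^ m) (f : 𝔽₂^ m → 𝔽₂^ k) →
  ∑ (vectors m) (λ v → does (v ≟v x) · f v) ≡ f x
∑-select [] f = identityʳ (f [])
∑-select {suc m} (false ∷ x) f = begin
  ∑ (map (false ∷_) (vectors m) ++ map (true ∷_) (vectors m)) _
    ≡⟨ ∑-++ (map (false ∷_) (vectors m)) (map (true ∷_) (vectors m)) _ ⟩
  ∑ (map (false ∷_) (vectors m)) _ ⊕ ∑ (map (true ∷_) (vectors m)) _
    ≡⟨ cong₂ _⊕_ (∑-map _ (false ∷_) (vectors m)) (∑-map _ (true ∷_) (vectors m)) ⟩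
  ∑ (vectors m) (λ v → does (v ≟v x) · f (false ∷ v)) ⊕ ∑ (vectors m) (λ _ → 𝟎)
    ≡⟨ cong₂ _⊕_ (∑-select x (f ∘ (false ∷_))) (∑-ε (vectors m)) ⟩
  f (false ∷ x) ⊕ 𝟎
    ≡⟨ identityʳ (f (false ∷ x)) ⟩
  f (false ∷ x) ∎
∑-select {suc m} (true ∷ x) f = begin
  ∑ (map (false ∷_) (vectors m) ++ map (true ∷_) (vectors m)) _
    ≡⟨ ∑-++ (map (false ∷_) (vectors m)) (map (true ∷_) (vectors m)) _ ⟩
  ∑ (map (false ∷_) (vectors m)) _ ⊕ ∑ (map (true ∷_) (vectors m)) _
    ≡⟨ cong₂ _⊕_ (∑-map _ (false ∷_) (vectors m)) (∑-map _ (true ∷_) (vectors m)) ⟩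
  ∑ (vectors m) (λ _ → 𝟎) ⊕ ∑ (vectors m) (λ v → does (v ≟v x) · f (true ∷ v))
    ≡⟨ cong₂ _⊕_ (∑-ε (vectors m)) (∑-select x (f ∘ (true ∷_))) ⟩
  𝟎 ⊕ f (true ∷ x)
    ≡⟨ ⊕-identityˡ (f (true ∷ x)) ⟩
  f (true ∷ x) ∎

odd-count-∷ : ∀ {m} (v x : 𝔽₂^ m) xs →
  odd (count v (x ∷ xs)) ≡ does (v ≟v x) xor odd (count v xs)
odd-count-∷ v x xs with does (v ≟v x)
... | false = refl
... | true = refl

sum-by-parity : ∀ {m} (xs : List (𝔽₂^ m)) → sum xs ≡ ∑ (vectors m) (λ v → odd (count v xs) · v)
sum-by-parity {m} [] = sym (∑-ε (vectors m))
sum-by-parity {m} (x ∷ xs) = sym (begin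
  ∑ (vectors m) (λ v → odd (count v (x ∷ xs)) · v)
    ≡⟨ ∑-cong (vectors m) (λ v → cong (_· v) (odd-count-∷ v x xs)) ⟩
  ∑ (vectors m) (λ v → (does (v ≟v x) xor odd (count v xs)) · v)
    ≡⟨ ∑-cong (vectors m) (λ v → ·-xor (does (v ≟v x)) (odd (count v xs)) v) ⟩
  ∑ (vectors m) (λ v → (does (v ≟v x) · v) ⊕ (odd (count v xs) · v))
    ≡⟨ ∑-∙ (vectors m) _ _ ⟩
  ∑ (vectors m) (λ v → does (v ≟v x) · v) ⊕ ∑ (vectors m) (λ v → odd (count v xs) · v)
    ≡⟨ cong₂ _⊕_ (∑-select x id) (sym (sum-by-parity xs)) ⟩
  x ⊕ sum xs ∎)

sum-map-false∷ : ∀ {m} (xs : List (𝔽₂^ m)) → sum (map (false ∷_) xs) ≡ false ∷ sum xs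
sum-map-false∷ [] = refl
sum-map-false∷ (x ∷ xs) = cong ((false ∷ x) ⊕_) (sum-map-false∷ xs)

sum-map-true∷ : ∀ {m} (xs : List (𝔽₂^ m)) → sum (map (true ∷_) xs) ≡ odd (length xs) ∷ sum xs
sum-map-true∷ [] = refl
sum-map-true∷ (x ∷ xs) = cong ((true ∷ x) ⊕_) (sum-map-true∷ xs)

odd-length-vectors : ∀ m → odd (length (vectors (suc m))) ≡ false
odd-length-vectors m = begin
  odd (length (map (false ∷_) (vectors m) ++ map (true ∷_) (vectors m)))
    ≡⟨ cong odd (length-++ (map (false ∷_) (vectors m))) ⟩
  odd (length (map (false ∷_) (vectors m)) + length (map (true ∷_) (vectors m)))
    ≡⟨ cong odd (cong₂ _+_ (length-map (false ∷_) (vectors m)) (length-map (true ∷_) (vectors m))) ⟩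
  odd (length (vectors m) + length (vectors m))
    ≡⟨ odd-double (length (vectors m)) ⟩
  false ∎

-- The elements of F₂^m sum to 0 when m ≥ 2: each coordinate is 1 in exactly
-- half of them, an even number.
sum-vectors : ∀ m → sum (vectors (suc (suc m))) ≡ 𝟎
sum-vectors m = begin
  sum (map (false ∷_) V ++ map (true ∷_) V)
    ≡⟨ sum-++ (map (false ∷_) V) (map (true ∷_) V) ⟩
  sum (map (false ∷_) V) ⊕ sum (map (true ∷_) V)
    ≡⟨ cong₂ _⊕_ (sum-map-false∷ V) (sum-map-true∷ V) ⟩
  odd (length V) ∷ (sum V ⊕ sum V)
    ≡⟨ cong₂ _∷_ (odd-length-vectors m) (⊕-self-inverse (sum V)) ⟩
  𝟎 ∎
  where
  V : List (𝔽₂^ (suc m))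
  V = vectors (suc m)

-- All labels of a labelled graph add up to the labels of its even-degree
-- vertices: each vertex label occurs once, plus once per incident edge.
sum-allLabels : ∀ {n m} (G : Graph n) (ℓ : Fin n → 𝔽₂^ m) → sum (allLabels G ℓ) ≡ evenDegreeSum G ℓ
sum-allLabels {n} G ℓ = begin
  sum (allLabels G ℓ)
    ≡⟨ sum-++ (map ℓ V) _ ⟩
  ∑ V ℓ ⊕ ∑ (edges G) (λ e → ℓ (proj₁ e) ⊕ ℓ (proj₂ e))
    ≡⟨ cong (∑ V ℓ ⊕_) (handshake G ℓ) ⟩
  ∑ V ℓ ⊕ ∑ V (λ i → odd (degree G i) · ℓ i)
    ≡⟨ sym (∑-∙ V ℓ _) ⟩
  ∑ V (λ i → ℓ i ⊕ (odd (degree G i) · ℓ i))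
    ≡⟨ ∑-cong V (λ i → trans (∙-· (odd (degree G i)) (ℓ i)) (cong (_· ℓ i) (sym (even?-odd (degree G i))))) ⟩
  ∑ V (λ i → does (degree G i % 2 ℕ.≟ 0) · ℓ i)
    ≡⟨ sym (∑-filter (λ i → degree G i % 2 ℕ.≟ 0) ℓ V) ⟩
  evenDegreeSum G ℓ ∎
  where
  V : List (Fin n)
  V = allFin n

-- In a set-sequential labelling every nonzero vector occurs exactly once
-- among all labels, so they add up to the sum of all of F₂^m.
sum-setSequential : ∀ {n m} (G : Graph n) (ℓ : Fin n → 𝔽₂^ m) →
  SetSequential G m ℓ → sum (allLabels G ℓ) ≡ sum (vectors m)
sum-setSequential {m = m} G ℓ S =
  trans (sum-by-parity (allLabels G ℓ)) (trans (∑-cong (vectors m) occurs-once) (∑-id (vectors m)))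
  where
  occurs-once : ∀ v → odd (count v (allLabels G ℓ)) · v ≡ v
  occurs-once v with v ≟v 𝟎
  ... | yes refl = ·-ε (odd (count 𝟎 (allLabels G ℓ)))
  ... | no v≢𝟎 = cong (λ c → odd c · v) (SetSequential.exactlyOnce S v v≢𝟎)

F₂⁰-trivial : (u : 𝔽₂^ 0) → u ≡ 𝟎
F₂⁰-trivial [] = refl

F₂¹-nonzero : (u : 𝔽₂^ 1) → u ≢ 𝟎 → u ≡ true ∷ []
F₂¹-nonzero (false ∷ []) u≢𝟎 = ⊥-elim (u≢𝟎 refl)
F₂¹-nonzero (true ∷ []) _ = refl

lemma13 : (n m : ℕ) → 2 ≤ n → (G : Graph n) → (ℓ : Fin n → 𝔽₂^ m) →
    SetSequential G m ℓ → evenDegreeSum G ℓ ≡ 𝟎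
lemma13 _ zero (s≤s (s≤s _)) G ℓ S = ⊥-elim (nonzero zero (F₂⁰-trivial (ℓ zero)))
  where open SetSequential S
lemma13 _ (suc zero) (s≤s (s≤s _)) G ℓ S =
  ⊥-elim (0≢1+n (distinct zero (suc zero) (trans (label-one zero) (sym (label-one (suc zero))))))
  where
  open SetSequential S
  label-one : ∀ i → ℓ i ≡ true ∷ []
  label-one i = F₂¹-nonzero (ℓ i) (nonzero i)
lemma13 _ (suc (suc m)) (s≤s (s≤s _)) G ℓ S = begin
  evenDegreeSum G ℓ           ≡⟨ sym (sum-allLabels G ℓ) ⟩
  sum (allLabels G ℓ)         ≡⟨ sum-setSequential G ℓ S ⟩
  sum (vectors (suc (suc m))) ≡⟨ sum-vectors m ⟩
  𝟎                           ∎
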